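{- Let $k\ge2$ and let $L$ be any input to bin packing with cardinality constraint $k$. In any optimal packing of $L$, every bin contains at most one item that First Fit (run on $L$) packs into a bin that ends up containing exactly one item.
   Context: Bin packing with cardinality constraints (BPCC): there is a global integer parameter $k\ge 2$; the input is a sequence of items with sizes $s_i\in(0,1]$. Items must be partitioned into bins so that each bin has total size at most $1$ and contains at most $k$ items; an optimal packing uses the minimum number of bins. First Fit (FF) packs each arriving item $i$ into the minimum-index (earliest opened) bin that currently has at most $k-1$ items and level at most $1-s_i$, opening a new bin if none exists.
   Formalization: The item sizes $s_i$ are rational. -}

module Defs where

open import Data.Nat as ℕ using (ℕ; zero; suc)
import Data.Nat.Properties as ℕP
open import Data.Rational as ℚ using (ℚ; 0ℚ; 1ℚ)
import Data.Rational.Properties as ℚP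
open import Data.Fin as Fin using (Fin)
import Data.Fin.Properties as FinP
open import Data.List using (List; []; _∷_; length; filter; foldr; lookup; allFin)
open import Data.Product using (_×_; _,_; proj₁; proj₂)
open import Relation.Nullary using (yes; no)
open import Relation.Binary.PropositionalEquality using (_≡_)

-- An instance: list of item sizes (rationals), in arrival order.
-- Items are indexed by Fin (length L); item i has size lookup L i.
Item : List ℚ → Set
Item L = Fin (length L)

size : (L : List ℚ) → Item L → ℚ
size L i = lookup L i

ValidInput : List ℚ → Set
ValidInput L = ∀ (i : Item L) → (0ℚ ℚ.< size L i) × (size L i ℚ.≤ 1ℚ)

Packing : List ℚ → ℕ → Set
Packing L m = Item L → Fin m

itemsIn : (L : List ℚ) {m : ℕ} → Packing L m → Fin m → List (Item L)
itemsIn L P b = filter (λ i → P i Fin.≟ b) (allFin (length L))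

binCount : (L : List ℚ) {m : ℕ} → Packing L m → Fin m → ℕ
binCount L P b = length (itemsIn L P b)

binLoad : (L : List ℚ) {m : ℕ} → Packing L m → Fin m → ℚ
binLoad L P b = foldr (λ i acc → size L i ℚ.+ acc) 0ℚ (itemsIn L P b)

Feasible : ℕ → (L : List ℚ) {m : ℕ} → Packing L m → Set
Feasible k L P = ∀ b → (binCount L P b ℕ.≤ k) × (binLoad L P b ℚ.≤ 1ℚ)

Optimal : ℕ → (L : List ℚ) {m : ℕ} → Packing L m → Set
Optimal k L {m} P =
  Feasible k L P × (∀ (m' : ℕ) (Q : Packing L m') → Feasible k L Q → m ℕ.≤ m')

-- First Fit.  A bin state is (number of items, level); bins are kept in
-- opening order (index 0 = earliest opened).

BinState : Set
BinState = ℕ × ℚ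

ffPlace : ℕ → ℚ → List BinState → ℕ × List BinState
ffPlace k x [] = 0 , ((1 , x) ∷ [])
ffPlace k x ((c , l) ∷ bs) with c ℕP.<? k | l ℚP.≤? (1ℚ ℚ.- x)
... | yes _ | yes _ = 0 , ((suc c , l ℚ.+ x) ∷ bs)
... | _     | _     = suc (proj₁ (ffPlace k x bs)) , ((c , l) ∷ proj₂ (ffPlace k x bs))

ffRun : ℕ → List BinState → List ℚ → List ℕ × List BinState
ffRun k bs [] = [] , bs
ffRun k bs (x ∷ xs) =
  proj₁ (ffPlace k x bs) ∷ proj₁ (ffRun k (proj₂ (ffPlace k x bs)) xs)
  , proj₂ (ffRun k (proj₂ (ffPlace k x bs)) xs)

at : {A : Set} → A → List A → ℕ → A
at d [] _ = d
at d (x ∷ _) zero = x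
at d (_ ∷ xs) (suc n) = at d xs n

ffBin : ℕ → (L : List ℚ) → Item L → ℕ
ffBin k L i = at 0 (proj₁ (ffRun k [] L)) (Fin.toℕ i)

ffFinalCount : ℕ → List ℚ → ℕ → ℕ
ffFinalCount k L j = proj₁ (at (0 , 0ℚ) (proj₂ (ffRun k [] L)) j)

FFSingleton : ℕ → (L : List ℚ) → Item L → Set
FFSingleton k L i = ffFinalCount k L (ffBin k L i) ≡ 1

module Submission where

-- If two items i < j both end up alone in their First Fit bins,
-- then size i + size j > 1.  Item i opened a fresh bin (a bin that already
-- held an item could not end with exactly one), and that bin still holds
-- only i when j arrives, so its count 1 is below k ≥ 2.  Because j also
-- opens a fresh bin, First Fit rejected i's bin, which is possible only on
-- level grounds: size i > 1 - size j.  A feasible packing, in particular an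
-- optimal one, has bin loads at most 1 and sizes are positive, so two such
-- items never share a bin.

open import Defs
open import Data.Nat using (ℕ; _≤_)
open import Data.Rational using (ℚ)
open import Data.List using (List)
open import Relation.Binary.PropositionalEquality using (_≡_)

open import Data.Nat using (zero; suc; z≤n; s≤s; _<_)
import Data.Nat.Properties as NP
import Data.Rational as Q
open Q using (0ℚ; 1ℚ)
import Data.Rational.Properties as QP
open import Data.List using ([]; _∷_; length; foldr; lookup)
open import Data.List.Relation.Unary.All using (All; []; _∷_)
open import Data.List.Relation.Unary.Any using (here; there)
open import Data.List.Membership.Propositional using (_∈_)
open import Data.List.Membership.Propositional.Properties using (∈-filter⁺; ∈-allFin)
open import Data.Product using (_×_; _,_; proj₁; proj₂)
open import Data.Sum using (_⊎_; inj₁; inj₂)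
open import Data.Empty using (⊥-elim)
open import Relation.Nullary using (yes; no; ¬_)
open import Relation.Binary using (tri<; tri≈; tri>)
open import Relation.Binary.PropositionalEquality
  using (refl; sym; trans; cong; subst; subst₂; module ≡-Reasoning)
import Data.Fin as F
import Data.Fin.Properties as FP

-- Bin states: (number of items, level); indexing past the end yields the
-- empty bin, matching the default used by ffFinalCount.
emptyBin : BinState
emptyBin = (0 , 0ℚ)

count : BinState → ℕ
count = proj₁

level : BinState → ℚ
level = proj₂

binAt : List BinState → ℕ → BinState
binAt = at emptyBin

Occupied : BinState → Set
Occupied s = 1 ≤ count s

binAt-beyond : ∀ bs q → length bs ≤ q → binAt bs q ≡ emptyBin
binAt-beyond [] q _ = refl
binAt-beyond (b ∷ bs) (suc q) (s≤s h) = binAt-beyond bs q h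

occupied⇒inRange : ∀ bs q → Occupied (binAt bs q) → q < length bs
occupied⇒inRange bs q occ with q NP.<? length bs
... | yes lt = lt
... | no ¬lt = ⊥-elim (NP.1+n≰n (subst Occupied (binAt-beyond bs q (NP.≮⇒≥ ¬lt)) occ))

all⇒binAt : ∀ {P : BinState → Set} bs q → All P bs → q < length bs → P (binAt bs q)
all⇒binAt (b ∷ bs) zero (p ∷ _) _ = p
all⇒binAt (b ∷ bs) (suc q) (_ ∷ ps) (s≤s lt) = all⇒binAt bs q ps lt

module Step (k : ℕ) (x : ℚ) where

  target : List BinState → ℕ
  target bs = proj₁ (ffPlace k x bs)

  placed : List BinState → List BinState
  placed bs = proj₂ (ffPlace k x bs)

  Fits : BinState → Set
  Fits s = (count s < k) × (level s Q.≤ 1ℚ Q.- x)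

  placed-other : ∀ bs q → ¬ (q ≡ target bs) → binAt (placed bs) q ≡ binAt bs q
  placed-other [] zero q≢t = ⊥-elim (q≢t refl)
  placed-other [] (suc q) q≢t = refl
  placed-other ((c , l) ∷ bs) q q≢t with c NP.<? k | l QP.≤? (1ℚ Q.- x)
  placed-other ((c , l) ∷ bs) zero q≢t    | yes _ | yes _ = ⊥-elim (q≢t refl)
  placed-other ((c , l) ∷ bs) (suc q) q≢t | yes _ | yes _ = refl
  placed-other ((c , l) ∷ bs) zero q≢t    | yes _ | no _  = refl
  placed-other ((c , l) ∷ bs) (suc q) q≢t | yes _ | no _  = placed-other bs q (λ e → q≢t (cong suc e))
  placed-other ((c , l) ∷ bs) zero q≢t    | no _  | _     = refl
  placed-other ((c , l) ∷ bs) (suc q) q≢t | no _  | _     = placed-other bs q (λ e → q≢t (cong suc e))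

  placed-target : ∀ bs → count (binAt (placed bs) (target bs)) ≡ suc (count (binAt bs (target bs)))
  placed-target [] = refl
  placed-target ((c , l) ∷ bs) with c NP.<? k | l QP.≤? (1ℚ Q.- x)
  ... | yes _ | yes _ = refl
  ... | yes _ | no _  = placed-target bs
  ... | no _  | _     = placed-target bs

  ExistingOrNew : List BinState → Set
  ExistingOrNew bs = (target bs < length bs)
                   ⊎ ((target bs ≡ length bs) × (binAt (placed bs) (target bs) ≡ (1 , x)))

  shift : ∀ {t n : ℕ} {s : BinState} →
          (t < n) ⊎ ((t ≡ n) × (s ≡ (1 , x))) →
          (suc t < suc n) ⊎ ((suc t ≡ suc n) × (s ≡ (1 , x)))
  shift (inj₁ lt) = inj₁ (s≤s lt)
  shift (inj₂ (eq , new)) = inj₂ (cong suc eq , new)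

  target-shape : ∀ bs → ExistingOrNew bs
  target-shape [] = inj₂ (refl , refl)
  target-shape ((c , l) ∷ bs) with c NP.<? k | l QP.≤? (1ℚ Q.- x)
  ... | yes _ | yes _ = inj₁ (s≤s z≤n)
  ... | yes _ | no _  = shift (target-shape bs)
  ... | no _  | _     = shift (target-shape bs)


  skipped-misfit : ∀ bs q → q < target bs → ¬ Fits (binAt bs q)
  skipped-misfit [] q () _
  skipped-misfit ((c , l) ∷ bs) q lt fits with c NP.<? k | l QP.≤? (1ℚ Q.- x)
  skipped-misfit ((c , l) ∷ bs) q       ()         _          | yes _ | yes _
  skipped-misfit ((c , l) ∷ bs) zero    _          (_ , room) | yes _ | no ¬room = ¬room room
  skipped-misfit ((c , l) ∷ bs) zero    _          (few , _)  | no ¬few | _      = ¬few few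
  skipped-misfit ((c , l) ∷ bs) (suc q) (s≤s lt) fits         | yes _ | no _   = skipped-misfit bs q lt fits
  skipped-misfit ((c , l) ∷ bs) (suc q) (s≤s lt) fits         | no _  | _      = skipped-misfit bs q lt fits

  placed-occupied : ∀ bs → All Occupied bs → All Occupied (placed bs)
  placed-occupied [] _ = s≤s z≤n ∷ []
  placed-occupied ((c , l) ∷ bs) (o ∷ os) with c NP.<? k | l QP.≤? (1ℚ Q.- x)
  ... | yes _ | yes _ = s≤s z≤n ∷ os
  ... | yes _ | no _  = o ∷ placed-occupied bs os
  ... | no _  | _     = o ∷ placed-occupied bs os

  count-grows : ∀ bs q → count (binAt bs q) ≤ count (binAt (placed bs) q)
  count-grows bs q with q NP.≟ target bs
  ... | yes refl = subst (count (binAt bs q) ≤_) (sym (placed-target bs)) (NP.n≤1+n _)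
  ... | no q≢t   = NP.≤-reflexive (cong count (sym (placed-other bs q q≢t)))

  same-count⇒unchanged : ∀ bs q → count (binAt (placed bs) q) ≡ count (binAt bs q) →
                         binAt (placed bs) q ≡ binAt bs q
  same-count⇒unchanged bs q same with q NP.≟ target bs
  ... | yes refl = ⊥-elim (NP.1+n≢n (trans (sym (placed-target bs)) same))
  ... | no q≢t   = placed-other bs q q≢t

finalBins : ℕ → List BinState → List ℚ → List BinState
finalBins k bs xs = proj₂ (ffRun k bs xs)

assignment : ℕ → List BinState → List ℚ → List ℕ
assignment k bs xs = proj₁ (ffRun k bs xs)

EndsSingleton : ℕ → List BinState → List ℚ → ℕ → Set
EndsSingleton k bs xs u = count (binAt (finalBins k bs xs) (at 0 (assignment k bs xs) u)) ≡ 1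

count-grows-run : ∀ k bs xs q → count (binAt bs q) ≤ count (binAt (finalBins k bs xs) q)
count-grows-run k bs [] q = NP.≤-refl
count-grows-run k bs (x ∷ xs) q =
  NP.≤-trans (Step.count-grows k x bs q) (count-grows-run k (Step.placed k x bs) xs q)

-- An item whose bin ends with one item opened that bin: a bin that was
-- already occupied would end with at least two items.
singleton⇒fresh : ∀ k x bs xs → All Occupied bs →
  count (binAt (finalBins k (Step.placed k x bs) xs) (Step.target k x bs)) ≡ 1 →
  (Step.target k x bs ≡ length bs) × (binAt (Step.placed k x bs) (Step.target k x bs) ≡ (1 , x))
singleton⇒fresh k x bs xs occupied ends1 with Step.target-shape k x bs
... | inj₂ fresh = fresh
... | inj₁ existing = ⊥-elim (NP.<⇒≱ (s≤s before≥1) (NP.≤-trans after≥ (NP.≤-reflexive ends1)))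
  where
    t : ℕ
    t = Step.target k x bs
    before≥1 : 1 ≤ count (binAt bs t)
    before≥1 = all⇒binAt bs t occupied existing
    after≥ : suc (count (binAt bs t)) ≤ count (binAt (finalBins k (Step.placed k x bs) xs) t)
    after≥ = subst (_≤ count (binAt (finalBins k (Step.placed k x bs) xs) t))
                   (Step.placed-target k x bs) (count-grows-run k (Step.placed k x bs) xs t)

-- With k ≥ 2 the count 1 is
-- no obstacle, so the level of q exceeds 1 - size u.
singleton-blocks : ∀ k → 2 ≤ k → ∀ bs xs q → All Occupied bs → count (binAt bs q) ≡ 1 →
  ∀ u → u < length xs → EndsSingleton k bs xs u →
  count (binAt (finalBins k bs xs) q) ≡ 1 →
  (1ℚ Q.- at 0ℚ xs u) Q.< level (binAt bs q)
singleton-blocks k k≥2 bs (x ∷ xs) q occupied q1 zero _ u1 _ = QP.≰⇒> doesNotFit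
  where
    fresh : (Step.target k x bs ≡ length bs) × (binAt (Step.placed k x bs) (Step.target k x bs) ≡ (1 , x))
    fresh = singleton⇒fresh k x bs xs occupied u1
    beforeTarget : q < Step.target k x bs
    beforeTarget = subst (q <_) (sym (proj₁ fresh)) (occupied⇒inRange bs q (NP.≤-reflexive (sym q1)))
    doesNotFit : ¬ (level (binAt bs q) Q.≤ 1ℚ Q.- x)
    doesNotFit room = Step.skipped-misfit k x bs q beforeTarget (subst (_< k) (sym q1) k≥2 , room)
singleton-blocks k k≥2 bs (x ∷ xs) q occupied q1 (suc u) (s≤s u<) u1 q1-final =
  subst (λ s → (1ℚ Q.- at 0ℚ xs u) Q.< level s) untouched
    (singleton-blocks k k≥2 bs′ xs q (Step.placed-occupied k x bs occupied) q1′ u u< u1 q1-final)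
  where
    bs′ : List BinState
    bs′ = Step.placed k x bs
    q1′ : count (binAt bs′ q) ≡ 1
    q1′ = NP.≤-antisym (subst (_ ≤_) q1-final (count-grows-run k bs′ xs q))
                       (subst (_≤ count (binAt bs′ q)) q1 (Step.count-grows k x bs q))
    untouched : binAt bs′ q ≡ binAt bs q
    untouched = Step.same-count⇒unchanged k x bs q (trans q1′ (sym q1))

singletons-overflow : ∀ k → 2 ≤ k → ∀ bs xs → All Occupied bs → ∀ t u → t < u → u < length xs →
  EndsSingleton k bs xs t → EndsSingleton k bs xs u →
  (1ℚ Q.- at 0ℚ xs u) Q.< at 0ℚ xs t
singletons-overflow k k≥2 bs (x ∷ xs) occupied zero (suc u) _ (s≤s u<) t1 u1 =
  subst (λ s → (1ℚ Q.- at 0ℚ xs u) Q.< level s) (proj₂ fresh)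
    (singleton-blocks k k≥2 (Step.placed k x bs) xs (Step.target k x bs)
       (Step.placed-occupied k x bs occupied) (cong count (proj₂ fresh)) u u< u1 t1)
  where
    fresh : (Step.target k x bs ≡ length bs) × (binAt (Step.placed k x bs) (Step.target k x bs) ≡ (1 , x))
    fresh = singleton⇒fresh k x bs xs occupied t1
singletons-overflow k k≥2 bs (x ∷ xs) occupied (suc t) (suc u) (s≤s t<u) (s≤s u<) t1 u1 =
  singletons-overflow k k≥2 (Step.placed k x bs) xs (Step.placed-occupied k x bs occupied) t u t<u u< t1 u1

at-lookup : ∀ (L : List ℚ) (i : F.Fin (length L)) → at 0ℚ L (F.toℕ i) ≡ lookup L i
at-lookup (x ∷ L) F.zero = refl
at-lookup (x ∷ L) (F.suc i) = at-lookup L i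

exceeds-one : ∀ a b → (1ℚ Q.- b) Q.< a → 1ℚ Q.< a Q.+ b
exceeds-one a b h = subst (Q._< a Q.+ b) cancel (QP.+-monoˡ-< b h)
  where
    open ≡-Reasoning
    cancel : (1ℚ Q.- b) Q.+ b ≡ 1ℚ
    cancel = begin
      (1ℚ Q.- b) Q.+ b    ≡⟨ QP.+-assoc 1ℚ (Q.- b) b ⟩
      1ℚ Q.+ (Q.- b Q.+ b) ≡⟨ cong (1ℚ Q.+_) (QP.+-inverseˡ b) ⟩
      1ℚ Q.+ 0ℚ            ≡⟨ QP.+-identityʳ 1ℚ ⟩
      1ℚ                   ∎

ordered-singletons-overflow : ∀ k → 2 ≤ k → (L : List ℚ) (i j : Item L) → F.toℕ i < F.toℕ j →
  FFSingleton k L i → FFSingleton k L j → 1ℚ Q.< size L i Q.+ size L j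
ordered-singletons-overflow k k≥2 L i j i<j si sj = exceeds-one (size L i) (size L j)
  (subst₂ (λ a b → (1ℚ Q.- b) Q.< a) (at-lookup L i) (at-lookup L j)
    (singletons-overflow k k≥2 [] L [] (F.toℕ i) (F.toℕ j) i<j (FP.toℕ<n j) si sj))

ff-singletons-overflow : ∀ k → 2 ≤ k → (L : List ℚ) (i j : Item L) → ¬ (i ≡ j) →
  FFSingleton k L i → FFSingleton k L j → 1ℚ Q.< size L i Q.+ size L j
ff-singletons-overflow k k≥2 L i j i≢j si sj with NP.<-cmp (F.toℕ i) (F.toℕ j)
... | tri< i<j _ _ = ordered-singletons-overflow k k≥2 L i j i<j si sj
... | tri≈ _ i=j _ = ⊥-elim (i≢j (FP.toℕ-injective i=j))
... | tri> _ _ j<i = subst (1ℚ Q.<_) (QP.+-comm (size L j) (size L i))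
  (ordered-singletons-overflow k k≥2 L j i j<i sj si)

module WeightedSum {A : Set} (w : A → ℚ) (w≥0 : ∀ a → 0ℚ Q.≤ w a) where

  total : List A → ℚ
  total = foldr (λ a acc → w a Q.+ acc) 0ℚ

  total≥0 : ∀ ys → 0ℚ Q.≤ total ys
  total≥0 [] = QP.≤-refl
  total≥0 (y ∷ ys) = subst (Q._≤ total (y ∷ ys)) (QP.+-identityʳ 0ℚ) (QP.+-mono-≤ (w≥0 y) (total≥0 ys))

  member≤total : ∀ ys a → a ∈ ys → w a Q.≤ total ys
  member≤total (y ∷ ys) a (here refl) =
    subst (Q._≤ total (y ∷ ys)) (QP.+-identityʳ (w a)) (QP.+-monoʳ-≤ (w a) (total≥0 ys))
  member≤total (y ∷ ys) a (there a∈) =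
    subst (Q._≤ total (y ∷ ys)) (QP.+-identityˡ (w a)) (QP.+-mono-≤ (w≥0 y) (member≤total ys a a∈))

  pair≤total : ∀ ys a b → a ∈ ys → b ∈ ys → ¬ (a ≡ b) → w a Q.+ w b Q.≤ total ys
  pair≤total (y ∷ ys) a b (here refl) (here refl) a≢b = ⊥-elim (a≢b refl)
  pair≤total (y ∷ ys) a b (here refl) (there b∈) _ = QP.+-monoʳ-≤ (w a) (member≤total ys b b∈)
  pair≤total (y ∷ ys) a b (there a∈) (here refl) _ =
    subst (Q._≤ total (y ∷ ys)) (QP.+-comm (w b) (w a)) (QP.+-monoʳ-≤ (w b) (member≤total ys a a∈))
  pair≤total (y ∷ ys) a b (there a∈) (there b∈) a≢b =
    subst (Q._≤ total (y ∷ ys)) (QP.+-identityˡ (w a Q.+ w b)) (QP.+-mono-≤ (w≥0 y) (pair≤total ys a b a∈ b∈ a≢b))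

same-bin-fits : ∀ k (L : List ℚ) → ValidInput L → ∀ {m} (P : Packing L m) → Feasible k L P →
  ∀ i j → P i ≡ P j → ¬ (i ≡ j) → size L i Q.+ size L j Q.≤ 1ℚ
same-bin-fits k L valid P feasible i j same i≢j =
  QP.≤-trans (pair≤total (itemsIn L P (P i)) i j i∈ j∈ i≢j) (proj₂ (feasible (P i)))
  where
    open WeightedSum (size L) (λ t → QP.<⇒≤ (proj₁ (valid t)))
    i∈ : i ∈ itemsIn L P (P i)
    i∈ = ∈-filter⁺ (λ t → P t F.≟ P i) (∈-allFin i) refl
    j∈ : j ∈ itemsIn L P (P i)
    j∈ = ∈-filter⁺ (λ t → P t F.≟ P i) (∈-allFin j) (sym same)

mainTheorem14 : (k : ℕ) → 2 ≤ k → (L : List ℚ) → ValidInput L →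
    (m : ℕ) (P : Packing L m) → Optimal k L P →
    ∀ (i j : Item L) → P i ≡ P j → FFSingleton k L i → FFSingleton k L j → i ≡ j
mainTheorem14 k k≥2 L valid m P (feasible , _) i j same si sj with i F.≟ j
... | yes i≡j = i≡j
... | no i≢j  = ⊥-elim (QP.<-irrefl refl (QP.<-≤-trans
                  (ff-singletons-overflow k k≥2 L i j i≢j si sj)
                  (same-bin-fits k L valid P feasible i j same i≢j)))
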